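{- Let $H$ be a colored graph. If $H$ has a guarded cutvertex decomposition with guard size at most $c$, then $H$ has treewidth at most $c$.
   Context: A colored graph is a finite simple graph with a (not necessarily proper) vertex coloring. $H^{\bullet}$ is obtained from $H$ by making every color class a clique. For a rooted tree decomposition $(T,\beta)$, $\sigma(t)=\beta(t)\cap\beta(\text{parent}(t))$ and $\sigma(\text{root})=\emptyset$. A guarded cutvertex decomposition of $H$ is $(T,\beta,g)$ with $(T,\beta)$ a rooted tree decomposition of $H^{\bullet}$ and $g:V(T)\to2^{V(H)}$ with $\sigma(t)\subseteq g(t)\subseteq\beta(t)$, such that $g(t)$ is a vertex cover of $H[\beta(t)]$ for all $t$ and $|\sigma(t')\setminus g(t)|\le1$ for every child $t'$ of $t$. Its guard size is $\max_t|g(t)|$. -}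

module Defs where

open import Data.Nat using (ℕ; zero; suc; _≤_; _≡ᵇ_)
open import Data.Bool using (Bool; true; false; _∨_; _∧_; not)
open import Data.Fin using (Fin; zero; suc; toℕ; _≟_)
open import Data.Fin.Subset using (Subset; _∈_; _⊆_; _∩_; _─_; ∣_∣; ⊥)
open import Data.Product using (Σ; ∃; _×_; _,_)
open import Data.Sum using (_⊎_)
open import Relation.Nullary.Decidable using (⌊_⌋)
open import Relation.Binary.PropositionalEquality using (_≡_)

record ColoredGraph (n : ℕ) : Set where
  field
    adj    : Fin n → Fin n → Bool
    sym    : ∀ u v → adj u v ≡ adj v u
    irrefl : ∀ v → adj v v ≡ false
    col    : Fin n → ℕ
open ColoredGraph public

adj• : ∀ {n} → ColoredGraph n → Fin n → Fin n → Bool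
adj• H u v = adj H u v ∨ ((col H u ≡ᵇ col H v) ∧ not ⌊ u ≟ v ⌋)

-- A rooted tree on nodes Fin (suc m); node zero is the root, and node
-- (suc i) has parent (parent i), which has a smaller index.  Every finite
-- rooted tree is isomorphic to one of this form (label nodes in BFS order).
record RootedTree : Set where
  field
    m        : ℕ
    parent   : Fin m → Fin (suc m)
    parent<  : ∀ i → toℕ (parent i) ≤ toℕ i
open RootedTree public

Node : RootedTree → Set
Node T = Fin (suc (m T))

TAdj : (T : RootedTree) → Node T → Node T → Set
TAdj T s t = (∃ λ i → s ≡ suc i × parent T i ≡ t) ⊎ (∃ λ i → t ≡ suc i × parent T i ≡ s)

data WalkIn (T : RootedTree) (P : Node T → Set) : Node T → Node T → Set where
  here : ∀ {s} → P s → WalkIn T P s s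
  step : ∀ {s t u} → P s → TAdj T s t → WalkIn T P t u → WalkIn T P s u

record IsTreeDecomposition {n : ℕ} (a : Fin n → Fin n → Bool)
         (T : RootedTree) (β : Node T → Subset n) : Set where
  field
    vertexCovered : ∀ v → ∃ λ t → v ∈ β t
    edgeCovered   : ∀ u v → a u v ≡ true → ∃ λ t → u ∈ β t × v ∈ β t
    connected     : ∀ v s t → v ∈ β s → v ∈ β t → WalkIn T (λ r → v ∈ β r) s t

σ : ∀ {n} (T : RootedTree) → (Node T → Subset n) → Node T → Subset n
σ T β zero    = ⊥
σ T β (suc i) = β (suc i) ∩ β (parent T i)

record GuardedCutvertexDecomposition {n : ℕ} (H : ColoredGraph n) (c : ℕ) : Set where
  field
    tree   : RootedTree
    β      : Node tree → Subset n
    g      : Node tree → Subset n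
    isTD   : IsTreeDecomposition (adj• H) tree β
    σ⊆g    : ∀ t → σ tree β t ⊆ g t
    g⊆β    : ∀ t → g t ⊆ β t
    cover  : ∀ t u v → u ∈ β t → v ∈ β t → adj H u v ≡ true → u ∈ g t ⊎ v ∈ g t
    child  : ∀ i → ∣ σ tree β (suc i) ─ g (parent tree i) ∣ ≤ 1
    guard  : ∀ t → ∣ g t ∣ ≤ c

TreewidthAtMost : ∀ {n} → ColoredGraph n → ℕ → Set
TreewidthAtMost H c =
  Σ RootedTree λ T → Σ (Node T → Subset _) λ β →
    IsTreeDecomposition (adj H) T β × (∀ t → ∣ β t ∣ ≤ suc c)

module Submission where

-- Replace every node t of T by a star: a hub with bag g(t), and
-- for every vertex x a pendant leaf with bag g(t) ∪ ({x} ∩ β(t)).  Each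
-- bag has at most c + 1 vertices, and since g(t) is a vertex cover of
-- H[β(t)] every edge of H inside β(t) lies in some pendant bag.  A non-root
-- node t' with parent t is attached by its hub to the star of t: to the
-- pendant of the at most one vertex of σ(t') ∖ g(t) if there is one, and to
-- the hub of t otherwise.  Connectivity of the occurrences of a vertex v
-- then follows by lifting a walk of T through v's bags: inside one star the
-- bags containing v are joined through the hub (or there is only one), and
-- across a tree edge v lies in the hub of t' (as σ(t') ⊆ g(t')) and in the
-- attachment node of t.

open import Defs hiding (sym)
open import Data.Nat using (ℕ; zero; suc; _≤_; _<_; _+_; _*_; z≤n; s≤s)
open import Data.Nat.Properties
  using (≤-trans; ≤-refl; <-irrefl; n≤1+n; m≤n⇒m≤1+n; m≤n+m; +-monoʳ-≤; +-monoʳ-<;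
         +-mono-≤; *-monoʳ-≤; +-suc; +-comm; *-suc; +-identityʳ; ≤-pred; module ≤-Reasoning)
open import Data.Bool using (true; _∨_)
open import Data.Fin using (Fin; zero; suc; toℕ; combine; remQuot)
open import Data.Fin.Properties using (remQuot-combine; combine-remQuot; toℕ-combine; toℕ≤pred[n])
open import Data.Fin.Subset using (Subset; _∈_; _∉_; _∩_; _∪_; _─_; ∣_∣; ⁅_⁆; inside; outside)
open import Data.Fin.Subset.Properties
  using (x∈⁅x⁆; x∈⁅y⁆⇒x≡y; ∣⁅x⁆∣≡1; x∈p∩q⁺; x∈p∩q⁻; x∈p∪q⁺; x∈p∪q⁻; ∣p∩q∣≤∣p∣;
         x∈p∧x∉q⇒x∈p─q; x∈p⇒∣p-x∣<∣p∣; _∈?_)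
open import Data.Vec.Base using ([]; _∷_; here; there)
open import Data.Product using (∃; _×_; _,_; proj₁; proj₂)
open import Data.Sum using (inj₁; inj₂)
open import Data.Empty using (⊥-elim)
open import Relation.Nullary using (yes; no)
open import Relation.Binary.PropositionalEquality using (_≡_; refl; sym; trans; cong; subst; subst₂)

TAdj-sym : ∀ {T : RootedTree} {s t : Node T} → TAdj T s t → TAdj T t s
TAdj-sym (inj₁ e) = inj₂ e
TAdj-sym (inj₂ e) = inj₁ e

module _ {T : RootedTree} {P : Node T → Set} where

  walk-start : ∀ {s t} → WalkIn T P s t → P s
  walk-start (here p)     = p
  walk-start (step p _ _) = p

  infixr 5 _++ʷ_
  _++ʷ_ : ∀ {s t u} → WalkIn T P s t → WalkIn T P t u → WalkIn T P s u
  here _     ++ʷ w' = w'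
  step p e w ++ʷ w' = step p e (w ++ʷ w')

  reverseʷ : ∀ {s t} → WalkIn T P s t → WalkIn T P t s
  reverseʷ (here p)     = here p
  reverseʷ (step p e w) = reverseʷ w ++ʷ step (walk-start w) (TAdj-sym {T} e) (here p)

∣p∪q∣≤∣p∣+∣q∣ : ∀ {k} (p q : Subset k) → ∣ p ∪ q ∣ ≤ ∣ p ∣ + ∣ q ∣
∣p∪q∣≤∣p∣+∣q∣ []            []            = z≤n
∣p∪q∣≤∣p∣+∣q∣ (inside  ∷ p) (inside  ∷ q) =
  s≤s (≤-trans (∣p∪q∣≤∣p∣+∣q∣ p q) (+-monoʳ-≤ ∣ p ∣ (n≤1+n ∣ q ∣)))
∣p∪q∣≤∣p∣+∣q∣ (inside  ∷ p) (outside ∷ q) = s≤s (∣p∪q∣≤∣p∣+∣q∣ p q)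
∣p∪q∣≤∣p∣+∣q∣ (outside ∷ p) (inside  ∷ q) =
  subst (suc ∣ p ∪ q ∣ ≤_) (sym (+-suc ∣ p ∣ ∣ q ∣)) (s≤s (∣p∪q∣≤∣p∣+∣q∣ p q))
∣p∪q∣≤∣p∣+∣q∣ (outside ∷ p) (outside ∷ q) = ∣p∪q∣≤∣p∣+∣q∣ p q

∈⇒1≤∣p∣ : ∀ {k} {x : Fin k} {p : Subset k} → x ∈ p → 1 ≤ ∣ p ∣
∈⇒1≤∣p∣ x∈p = ≤-trans (s≤s z≤n) (x∈p⇒∣p-x∣<∣p∣ x∈p)

shiftElement : ∀ {k} → Fin (suc k) → Fin (suc (suc k))
shiftElement zero    = zero
shiftElement (suc x) = suc (suc x)

-- The first element of a subset, as suc x, or zero for the empty set.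
firstElement : ∀ {k} → Subset k → Fin (suc k)
firstElement []            = zero
firstElement (inside  ∷ p) = suc zero
firstElement (outside ∷ p) = shiftElement (firstElement p)

firstElement-singleton : ∀ {k} (p : Subset k) {x} → x ∈ p → ∣ p ∣ ≤ 1 → firstElement p ≡ suc x
firstElement-singleton (inside  ∷ p) here        _           = refl
firstElement-singleton (inside  ∷ p) (there x∈p) (s≤s ∣p∣≤0) =
  ⊥-elim (<-irrefl refl (≤-trans (∈⇒1≤∣p∣ x∈p) ∣p∣≤0))
firstElement-singleton (outside ∷ p) (there x∈p) ∣p∣≤1 =
  cong shiftElement (firstElement-singleton p x∈p ∣p∣≤1)

treeFrom : (M : ℕ) (up : Fin (suc M) → Fin (suc M)) →
           (∀ a → 0 < toℕ a → toℕ (up a) < toℕ a) → RootedTree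
treeFrom M up lowers = record
  { m = M ; parent = λ i → up (suc i) ; parent< = λ i → ≤-pred (lowers (suc i) (s≤s z≤n)) }

treeFrom-edge : ∀ {M up lowers} a → 0 < toℕ a → TAdj (treeFrom M up lowers) a (up a)
treeFrom-edge (suc i) _ = inj₁ (i , refl , refl)

module StarExpansion {n : ℕ} (H : ColoredGraph n) (c : ℕ)
                     (D : GuardedCutvertexDecomposition H c) where
  open GuardedCutvertexDecomposition D
  open IsTreeDecomposition isTD

  -- Nodes of the new tree are pairs (t , j) of a node t of T and a slot
  -- j : Fin (suc n); slot zero is the hub of t, slot (suc x) the pendant
  -- of x.
  Slot : Set
  Slot = Fin (suc n)

  -- T' has suc M = (number of nodes of T) * (suc n) nodes
  M : ℕ
  M = n + m tree * suc n

  unguarded : Fin (m tree) → Subset n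
  unguarded i = σ tree β (suc i) ─ g (parent tree i)

  attach : Fin (m tree) → Slot
  attach i = firstElement (unguarded i)

  position : Fin (suc M) → Node tree × Slot
  position = remQuot {suc (m tree)} (suc n)

  node : Node tree → Slot → Fin (suc M)
  node = combine

  node-position : ∀ a → node (proj₁ (position a)) (proj₂ (position a)) ≡ a
  node-position = combine-remQuot {suc (m tree)} (suc n)

  position-node : ∀ t j → position (node t j) ≡ (t , j)
  position-node = remQuot-combine

  up : Node tree × Slot → Fin (suc M)
  up (t , suc x)     = node t zero
  up (zero , zero)   = zero
  up (suc i , zero)  = node (parent tree i) (attach i)

  up-lowers : ∀ t j → 0 < toℕ (node t j) → toℕ (up (t , j)) < toℕ (node t j)
  up-lowers t (suc x) _ rewrite toℕ-combine t (zero {n}) | toℕ-combine t (suc x) =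
    +-monoʳ-< (suc n * toℕ t) (s≤s z≤n)
  up-lowers (suc i) zero _ rewrite toℕ-combine (parent tree i) (attach i) | toℕ-combine (suc i) (zero {n}) =
    begin-strict
      suc n * toℕ (parent tree i) + toℕ (attach i)
        ≤⟨ +-mono-≤ (*-monoʳ-≤ (suc n) (parent< tree i)) (toℕ≤pred[n] (attach i)) ⟩
      suc n * toℕ i + n
        <⟨ +-monoʳ-< (suc n * toℕ i) ≤-refl ⟩
      suc n * toℕ i + suc n
        ≡⟨ +-comm (suc n * toℕ i) (suc n) ⟩
      suc n + suc n * toℕ i
        ≡⟨ *-suc (suc n) (toℕ i) ⟨
      suc n * suc (toℕ i)
        ≡⟨ +-identityʳ _ ⟨
      suc n * suc (toℕ i) + 0
    ∎
    where open ≤-Reasoning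

  upNode : Fin (suc M) → Fin (suc M)
  upNode a = up (position a)

  upNode-lowers : ∀ a → 0 < toℕ a → toℕ (upNode a) < toℕ a
  upNode-lowers a pos = subst (λ b → toℕ (upNode a) < toℕ b) (node-position a)
                          (up-lowers (proj₁ (position a)) (proj₂ (position a))
                            (subst (λ b → 0 < toℕ b) (sym (node-position a)) pos))

  T' : RootedTree
  T' = treeFrom M upNode upNode-lowers

  up-edge : ∀ t j → 0 < toℕ (node t j) → TAdj T' (node t j) (up (t , j))
  up-edge t j pos = subst (TAdj T' (node t j)) (cong up (position-node t j))
                          (treeFrom-edge {M} {upNode} {upNode-lowers} (node t j) pos)

  pendant-pos : ∀ t x → 0 < toℕ (node t (suc x))
  pendant-pos t x rewrite toℕ-combine t (suc x) = ≤-trans (s≤s z≤n) (m≤n+m (suc (toℕ x)) (suc n * toℕ t))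

  hub-pos : ∀ i → 0 < toℕ (node (suc i) zero)
  hub-pos i rewrite toℕ-combine (suc i) (zero {n}) = s≤s z≤n

  bag : Node tree × Slot → Subset n
  bag (t , zero)  = g t
  bag (t , suc x) = g t ∪ (⁅ x ⁆ ∩ β t)

  β' : Node T' → Subset n
  β' a = bag (position a)

  ∈β' : ∀ {v} t j → v ∈ bag (t , j) → v ∈ β' (node t j)
  ∈β' {v} t j v∈ = subst (λ r → v ∈ bag r) (sym (position-node t j)) v∈

  bag-size : ∀ r → ∣ bag r ∣ ≤ suc c
  bag-size (t , zero)  = m≤n⇒m≤1+n (guard t)
  bag-size (t , suc x) = begin
    ∣ g t ∪ (⁅ x ⁆ ∩ β t) ∣     ≤⟨ ∣p∪q∣≤∣p∣+∣q∣ (g t) (⁅ x ⁆ ∩ β t) ⟩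
    ∣ g t ∣ + ∣ ⁅ x ⁆ ∩ β t ∣   ≤⟨ +-mono-≤ (guard t) (∣p∩q∣≤∣p∣ ⁅ x ⁆ (β t)) ⟩
    c + ∣ ⁅ x ⁆ ∣               ≡⟨ cong (c +_) (∣⁅x⁆∣≡1 x) ⟩
    c + 1                       ≡⟨ +-comm c 1 ⟩
    suc c                       ∎
    where open ≤-Reasoning

  guard∈bag : ∀ {v} t j → v ∈ g t → v ∈ bag (t , j)
  guard∈bag t zero    v∈g = v∈g
  guard∈bag t (suc x) v∈g = x∈p∪q⁺ (inj₁ v∈g)

  bag⊆β : ∀ {v} t j → v ∈ bag (t , j) → v ∈ β t
  bag⊆β t zero    v∈ = g⊆β t v∈
  bag⊆β t (suc x) v∈ with x∈p∪q⁻ (g t) _ v∈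
  ... | inj₁ v∈g = g⊆β t v∈g
  ... | inj₂ v∈x = proj₂ (x∈p∩q⁻ _ _ v∈x)

  ∈pendant : ∀ {v} t → v ∈ β t → v ∈ bag (t , suc v)
  ∈pendant {v} t v∈β = x∈p∪q⁺ (inj₂ (x∈p∩q⁺ (x∈⁅x⁆ v , v∈β)))

  unguarded-slot : ∀ {v} t j → v ∉ g t → v ∈ bag (t , j) → j ≡ suc v
  unguarded-slot t zero    v∉g v∈ = ⊥-elim (v∉g v∈)
  unguarded-slot t (suc x) v∉g v∈ with x∈p∪q⁻ (g t) _ v∈
  ... | inj₁ v∈g = ⊥-elim (v∉g v∈g)
  ... | inj₂ v∈x = cong suc (sym (x∈⁅y⁆⇒x≡y x (proj₁ (x∈p∩q⁻ _ _ v∈x))))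

  module Occurrences (v : Fin n) where
    Holds : Node T' → Set
    Holds a = v ∈ β' a

    toHub : ∀ t → v ∈ g t → ∀ j → WalkIn T' Holds (node t j) (node t zero)
    toHub t v∈g zero    = here (∈β' t zero v∈g)
    toHub t v∈g (suc x) = step (∈β' t (suc x) (guard∈bag t (suc x) v∈g))
                               (up-edge t (suc x) (pendant-pos t x))
                               (here (∈β' t zero v∈g))

    withinStar : ∀ t j j' → v ∈ bag (t , j) → v ∈ bag (t , j') →
                 WalkIn T' Holds (node t j) (node t j')
    withinStar t j j' v∈ v∈' with v ∈? g t
    ... | yes v∈g = toHub t v∈g j ++ʷ reverseʷ (toHub t v∈g j')
    ... | no  v∉g = subst (λ k → WalkIn T' Holds (node t j) (node t k))
                          (trans (unguarded-slot t j v∉g v∈) (sym (unguarded-slot t j' v∉g v∈')))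
                          (here (∈β' t j v∈))

    shared∈hub : ∀ i → v ∈ β (suc i) → v ∈ β (parent tree i) → v ∈ g (suc i)
    shared∈hub i v∈ v∈p = σ⊆g (suc i) (x∈p∩q⁺ (v∈ , v∈p))

    shared∈attach : ∀ i → v ∈ β (suc i) → v ∈ β (parent tree i) → v ∈ bag (parent tree i , attach i)
    shared∈attach i v∈ v∈p with v ∈? g (parent tree i)
    ... | yes v∈g = guard∈bag (parent tree i) (attach i) v∈g
    ... | no  v∉g = subst (λ k → v ∈ bag (parent tree i , k))
                          (sym (firstElement-singleton (unguarded i)
                                  (x∈p∧x∉q⇒x∈p─q (x∈p∩q⁺ (v∈ , v∈p)) v∉g) (child i)))
                          (∈pendant (parent tree i) v∈p)

    acrossEdge : ∀ i → v ∈ β (suc i) → v ∈ β (parent tree i) →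
                 WalkIn T' Holds (node (suc i) zero) (node (parent tree i) (attach i))
    acrossEdge i v∈ v∈p = step (∈β' (suc i) zero (shared∈hub i v∈ v∈p))
                               (up-edge (suc i) zero (hub-pos i))
                               (here (∈β' (parent tree i) (attach i) (shared∈attach i v∈ v∈p)))

    lift : ∀ {s u} → WalkIn tree (λ r → v ∈ β r) s u → ∀ j j' →
           v ∈ bag (s , j) → v ∈ bag (u , j') → WalkIn T' Holds (node s j) (node u j')
    lift {s} (here _) j j' v∈ v∈' = withinStar s j j' v∈ v∈'
    lift (step v∈ (inj₁ (i , refl , refl)) w) j j' v∈s v∈u =
      withinStar (suc i) j zero v∈s (shared∈hub i v∈ (walk-start w))
      ++ʷ acrossEdge i v∈ (walk-start w)
      ++ʷ lift w (attach i) j' (shared∈attach i v∈ (walk-start w)) v∈u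
    lift (step v∈ (inj₂ (i , refl , refl)) w) j j' v∈s v∈u =
      withinStar (parent tree i) j (attach i) v∈s (shared∈attach i (walk-start w) v∈)
      ++ʷ reverseʷ (acrossEdge i (walk-start w) v∈)
      ++ʷ lift w zero j' (shared∈hub i (walk-start w) v∈) v∈u

  connected' : ∀ v a b → v ∈ β' a → v ∈ β' b → WalkIn T' (λ r → v ∈ β' r) a b
  connected' v a b v∈a v∈b =
    subst₂ (WalkIn T' (λ r → v ∈ β' r)) (node-position a) (node-position b)
      (Occurrences.lift v (connected v s u (bag⊆β s j v∈a) (bag⊆β u j' v∈b)) j j' v∈a v∈b)
    where
    s = proj₁ (position a)
    j = proj₂ (position a)
    u = proj₁ (position b)
    j' = proj₂ (position b)

  vertexCovered' : ∀ v → ∃ λ a → v ∈ β' a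
  vertexCovered' v with vertexCovered v
  ... | t , v∈β = node t (suc v) , ∈β' t (suc v) (∈pendant t v∈β)

  -- An edge uv lies in some β(t) (edges of H are edges of H•), where g(t)
  -- covers it; the pendant of the other endpoint then holds both.
  edgeCovered' : ∀ u v → adj H u v ≡ true → ∃ λ a → u ∈ β' a × v ∈ β' a
  edgeCovered' u v uv with edgeCovered u v (cong (_∨ _) uv)
  ... | t , u∈β , v∈β with cover t u v u∈β v∈β uv
  ... | inj₁ u∈g = node t (suc v) , ∈β' t (suc v) (guard∈bag t (suc v) u∈g) , ∈β' t (suc v) (∈pendant t v∈β)
  ... | inj₂ v∈g = node t (suc u) , ∈β' t (suc u) (∈pendant t u∈β) , ∈β' t (suc u) (guard∈bag t (suc u) v∈g)

  isTD' : IsTreeDecomposition (adj H) T' β'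
  isTD' = record { vertexCovered = vertexCovered' ; edgeCovered = edgeCovered' ; connected = connected' }

lemma6p6 : ∀ (n : ℕ) (H : ColoredGraph n) (c : ℕ) →
    GuardedCutvertexDecomposition H c → TreewidthAtMost H c
lemma6p6 n H c D = T' , β' , isTD' , λ a → bag-size (position a)
  where open StarExpansion H c D
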